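{- For every integer $m\in\mathbb{Z}$, every positive integer $n$ and every complex number $a$, \[ \sum_{ \pi \in \mathcal{D}(n) } (-1)^{ \#(\pi)-1 } \sum_{j=1}^{s(\pi)} \big(\ell(\pi) - s(\pi) + j \big)^m a^{\ell(\pi) - s(\pi) +j}= \sum_{d | n} d^m a^d, \] where the sum on the right is over the positive divisors $d$ of $n$.
   Context: $\mathcal{D}(n)$ denotes the set of partitions of $n$ into distinct parts. For a partition $\pi$, $s(\pi)$ is its smallest part, $\ell(\pi)$ its largest part, and $\#(\pi)$ its number of parts. -}

module Defs where

open import Level using (Level)
open import Data.Nat as ℕ using (ℕ; zero; suc; _∸_; _⊔_; _⊓_; _^_)
open import Data.Nat.Properties using (m^n≢0)
open import Data.Nat.Divisibility using (_∣?_)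
open import Data.Integer as ℤ using (ℤ; +_; -[1+_])
open import Data.Rational as ℚ using (ℚ; 1/_)
open import Data.Rational.Properties using (+-*-rawRing)
open import Data.List using (List; []; _∷_; map; filter; upTo; length)
open import Data.Nat.ListAction using (sum)
open import Data.Product using (Σ; _×_)
open import Relation.Binary.PropositionalEquality using (_≡_)
open import Relation.Nullary.Decidable using (⌊_⌋)
open import Algebra.Bundles using (CommutativeRing)
open import Algebra.Morphism.Structures using (module RingMorphisms)

sublists : {A : Set} → List A → List (List A)
sublists []       = [] ∷ []
sublists (x ∷ xs) = map (x ∷_) (sublists xs) Data.List.++ sublists xs
  where import Data.List

oneTo : ℕ → List ℕ
oneTo n = map suc (upTo n)

-- 𝒟(n): partitions of n into distinct parts, each listed once as the
-- (increasing) list of its parts, i.e. the subsets of {1,…,n} with sum n.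
𝒟 : ℕ → List (List ℕ)
𝒟 n = filter (λ π → sum π ℕ.≟ n) (sublists (oneTo n))

#parts : List ℕ → ℕ
#parts = length

-- smallest part s(π)  (value on the empty partition is irrelevant: 0)
smallest : List ℕ → ℕ
smallest []       = 0
smallest (x ∷ xs) = Data.List.foldr _⊓_ x xs
  where import Data.List

-- largest part ℓ(π)  (parts are positive, so 0 is a neutral start)
largest : List ℕ → ℕ
largest = Data.List.foldr _⊔_ 0
  where import Data.List

divisors : ℕ → List ℕ
divisors n = filter (λ d → d ∣? n) (oneTo n)

-- Integer powers of natural numbers in ℚ:  x ^ m  for m ∈ ℤ.
-- (Only used with x ≥ 1; for x = 0 and m < 0 we return 0 by convention.)

zpow : ℕ → ℤ → ℚ
zpow x       (+ k)     = (+ (x ^ k)) ℚ./ 1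
zpow zero    -[1+ k ]  = ℚ.0ℚ
zpow (suc x) -[1+ k ]  = (+ 1) ℚ./ (suc x ^ suc k)
  where instance _ = m^n≢0 (suc x) (suc k)

module _ {c ℓ : Level} (R : CommutativeRing c ℓ) where
  open CommutativeRing R

  powR : Carrier → ℕ → Carrier
  powR x zero    = 1#
  powR x (suc k) = x * powR x k

  signR : ℕ → Carrier
  signR zero    = 1#
  signR (suc k) = - signR k

  sumR : List Carrier → Carrier
  sumR []       = 0#
  sumR (x ∷ xs) = x + sumR xs

  IsRingHomFromℚ : (ℚ → Carrier) → Set ℓ
  IsRingHomFromℚ ι = RingMorphisms.IsRingHomomorphism +-*-rawRing rawRing ι

  module _ (ι : ℚ → Carrier) (m : ℤ) (a : Carrier) where
    term : ℕ → Carrier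
    term x = ι (zpow x m) * powR a x

    LHS : ℕ → Carrier
    LHS n = sumR (map (λ π → signR (#parts π ∸ 1)
                      * sumR (map (λ j → term (largest π ∸ smallest π ℕ.+ j))
                                  (oneTo (smallest π))))
                      (𝒟 n))

    RHS : ℕ → Carrier
    RHS n = sumR (map term (divisors n))

module Submission where

open import Defs
open import Level using (Level)
open import Function using (_∘_)
open import Function.Bundles using (mk⇔)
open import Data.Bool using (Bool; true; false; if_then_else_)
open import Data.Product using (_×_; _,_; proj₁; proj₂)
open import Data.Sum using (inj₁; inj₂)
open import Data.Nat as ℕ using (ℕ; zero; suc; _∸_; _≤_; _<_; z≤n; s≤s; _≡ᵇ_; NonZero)
import Data.Nat.Properties as ℕ
open import Data.Nat.Induction using (<-rec)
open import Data.Nat.Divisibility using (_∣_; _∣?_; _∣0; ∣m+n∣m⇒∣n; ∣m∣n⇒∣m+n; ∣⇒≤; ∣-refl)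
open import Data.Nat.ListAction using (sum)
open import Data.Nat.ListAction.Properties using (sum-++)
open import Data.Integer as ℤ using (ℤ; 0ℤ; 1ℤ; +_; -[1+_])
import Data.Integer.Properties as ℤ
open import Data.Integer.Tactic.RingSolver using (solve-∀)
open import Data.Rational using (ℚ)
open import Data.List using (List; []; _∷_; _++_; [_]; map; filter; length; upTo)
import Data.List.Properties as List
open import Data.List.Relation.Unary.All as All using (All; []; _∷_)
open import Data.List.Relation.Unary.All.Properties using (++⁺; map⁺)
open import Relation.Nullary using (does)
open import Relation.Nullary.Decidable using (does-⇔; dec-true; dec-false)
open import Relation.Unary using (Pred; Decidable)
open import Relation.Binary.PropositionalEquality as ≡ using (_≡_; _≢_)
open import Algebra.Bundles using (CommutativeRing)

-- Expanding the inner sums, the left-hand side is Σ_x c(n,x) x^m a^x, where c(n,x) is the signed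
-- count of the π ∈ 𝒟(n) with ℓ(π) − s(π) < x ≤ ℓ(π), i.e. of the π whose parts lie in a window
-- (M − x, M] containing the largest part M.  Fix x ≥ 1, put
-- W_t = {t+1, …, t+x−1} and A_t = ∏_{w ∈ W_t} (1 − q^w).  Splitting off the largest part M = x + t,
-- Σ_n c(n,x) q^n = q^x G with G = Σ_t q^t A_t.  Since W_t ∪ {x+t} = {t+1} ∪ W_{t+1}, we have
-- (1 − q^{x+t}) A_t = (1 − q^{t+1}) A_{t+1}, and summing over t telescopes to q^x G = G − 1.
-- Hence q^x G = q^x / (1 − q^x) and c(n,x) = [x ∣ n] for n ≥ 1.
-- A power series is represented by its coefficient function ℕ → ℤ, q^c f by shift c f, and
-- ∏_{w ∈ W} (1 − q^w) by signedSubsets W.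

All-sublists : {A : Set} {p : Level} {P : Pred A p} {xs : List A} → All P xs → All (All P) (sublists xs)
All-sublists []       = [] ∷ []
All-sublists (p ∷ ps) = ++⁺ (map⁺ (All.map (p ∷_) (All-sublists ps))) (All-sublists ps)

module ListSum {c ℓ : Level} (R : CommutativeRing c ℓ) where
  open CommutativeRing R
  open import Relation.Binary.Reasoning.Setoid setoid
  open import Algebra.Properties.CommutativeSemigroup +-commutativeSemigroup using (interchange)
  open import Algebra.Properties.Ring ring using (-‿+-comm; -0#≈0#)

  ∑ : {A : Set} → (A → Carrier) → List A → Carrier
  ∑ f xs = sumR R (map f xs)

  module _ {A : Set} where

    ∑-++ : (f : A → Carrier) (xs ys : List A) → ∑ f (xs ++ ys) ≈ ∑ f xs + ∑ f ys
    ∑-++ f []       ys = sym (+-identityˡ _)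
    ∑-++ f (x ∷ xs) ys = trans (+-congˡ (∑-++ f xs ys)) (sym (+-assoc _ _ _))

    ∑-map : {B : Set} (f : A → Carrier) (g : B → A) (xs : List B) → ∑ f (map g xs) ≈ ∑ (f ∘ g) xs
    ∑-map f g xs = reflexive (≡.cong (sumR R) (≡.sym (List.map-∘ xs)))

    ∑-cong : {f g : A → Carrier} → (∀ x → f x ≈ g x) → (xs : List A) → ∑ f xs ≈ ∑ g xs
    ∑-cong f≈g []       = refl
    ∑-cong f≈g (x ∷ xs) = +-cong (f≈g x) (∑-cong f≈g xs)

    ∑-congᴬ : {p : Level} {P : Pred A p} {f g : A → Carrier} → (∀ {x} → P x → f x ≈ g x) →
              {xs : List A} → All P xs → ∑ f xs ≈ ∑ g xs
    ∑-congᴬ f≈g []       = refl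
    ∑-congᴬ f≈g (p ∷ ps) = +-cong (f≈g p) (∑-congᴬ f≈g ps)

    ∑-zero : (xs : List A) → ∑ (λ _ → 0#) xs ≈ 0#
    ∑-zero []       = refl
    ∑-zero (x ∷ xs) = trans (+-identityˡ _) (∑-zero xs)

    ∑-+ : (f g : A → Carrier) (xs : List A) → ∑ (λ x → f x + g x) xs ≈ ∑ f xs + ∑ g xs
    ∑-+ f g []       = sym (+-identityˡ _)
    ∑-+ f g (x ∷ xs) = trans (+-congˡ (∑-+ f g xs)) (interchange _ _ _ _)

    ∑-neg : (f : A → Carrier) (xs : List A) → ∑ (λ x → - f x) xs ≈ - ∑ f xs
    ∑-neg f []       = sym -0#≈0#
    ∑-neg f (x ∷ xs) = trans (+-congˡ (∑-neg f xs)) (-‿+-comm _ _)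

    ∑-*ˡ : (a : Carrier) (f : A → Carrier) (xs : List A) → a * ∑ f xs ≈ ∑ (λ x → a * f x) xs
    ∑-*ˡ a f []       = zeroʳ a
    ∑-*ˡ a f (x ∷ xs) = trans (distribˡ _ _ _) (+-congˡ (∑-*ˡ a f xs))

    ∑-*ʳ : (a : Carrier) (f : A → Carrier) (xs : List A) → ∑ f xs * a ≈ ∑ (λ x → f x * a) xs
    ∑-*ʳ a f []       = zeroˡ a
    ∑-*ʳ a f (x ∷ xs) = trans (distribʳ _ _ _) (+-congˡ (∑-*ʳ a f xs))

    ∑-filter : {p : Level} {P : Pred A p} (P? : Decidable P) (f : A → Carrier) (xs : List A) →
               ∑ f (filter P? xs) ≈ ∑ (λ x → if does (P? x) then f x else 0#) xs
    ∑-filter P? f []       = refl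
    ∑-filter P? f (x ∷ xs) with does (P? x)
    ... | true  = +-congˡ (∑-filter P? f xs)
    ... | false = trans (∑-filter P? f xs) (sym (+-identityˡ _))

  ∑-swap : {A B : Set} (f : A → B → Carrier) (xs : List A) (ys : List B) →
           ∑ (λ x → ∑ (f x) ys) xs ≈ ∑ (λ y → ∑ (λ x → f x y) xs) ys
  ∑-swap f []       ys = sym (∑-zero ys)
  ∑-swap f (x ∷ xs) ys = trans (+-congˡ (∑-swap f xs ys)) (sym (∑-+ (f x) _ ys))

  module _ {A : Set} where

    ∑-sublists-∷ : (f : List A → Carrier) (a : A) (xs : List A) →
                   ∑ f (sublists (a ∷ xs)) ≈ ∑ (f ∘ (a ∷_)) (sublists xs) + ∑ f (sublists xs)
    ∑-sublists-∷ f a xs = trans (∑-++ f (map (a ∷_) (sublists xs)) _) (+-congʳ (∑-map f (a ∷_) (sublists xs)))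

    ∑-sublists-∷ʳ : (f : List A → Carrier) (xs : List A) (c : A) →
                    ∑ f (sublists (xs ++ [ c ])) ≈ ∑ (λ ys → f (ys ++ [ c ])) (sublists xs) + ∑ f (sublists xs)
    ∑-sublists-∷ʳ f []       c = +-congʳ (sym (+-identityʳ _))
    ∑-sublists-∷ʳ f (a ∷ xs) c = begin
      ∑ f (sublists (a ∷ xs ++ [ c ]))
        ≈⟨ ∑-sublists-∷ f a (xs ++ [ c ]) ⟩
      ∑ (f ∘ (a ∷_)) (sublists (xs ++ [ c ])) + ∑ f (sublists (xs ++ [ c ]))
        ≈⟨ +-cong (∑-sublists-∷ʳ (f ∘ (a ∷_)) xs c) (∑-sublists-∷ʳ f xs c) ⟩
      (∑ (λ ys → f (a ∷ ys ++ [ c ])) S + ∑ (f ∘ (a ∷_)) S) + (∑ (λ ys → f (ys ++ [ c ])) S + ∑ f S)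
        ≈⟨ interchange _ _ _ _ ⟩
      (∑ (λ ys → f (a ∷ ys ++ [ c ])) S + ∑ (λ ys → f (ys ++ [ c ])) S) + (∑ (f ∘ (a ∷_)) S + ∑ f S)
        ≈⟨ +-cong (sym (∑-sublists-∷ (λ ys → f (ys ++ [ c ])) a xs)) (sym (∑-sublists-∷ f a xs)) ⟩
      ∑ (λ ys → f (ys ++ [ c ])) (sublists (a ∷ xs)) + ∑ f (sublists (a ∷ xs)) ∎
      where S = sublists xs

    ∑-sublists-++-vanishingˡ : {p : Level} {P : Pred A p} (f : List A → Carrier) →
      (∀ {a} ys → P a → f (a ∷ ys) ≈ 0#) → {xs : List A} → All P xs → (zs : List A) →
      ∑ f (sublists (xs ++ zs)) ≈ ∑ f (sublists zs)
    ∑-sublists-++-vanishingˡ f vanish []                 zs = refl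
    ∑-sublists-++-vanishingˡ f vanish {a ∷ xs} (pa ∷ ps) zs = begin
      ∑ f (sublists (a ∷ xs ++ zs))
        ≈⟨ ∑-sublists-∷ f a (xs ++ zs) ⟩
      ∑ (f ∘ (a ∷_)) (sublists (xs ++ zs)) + ∑ f (sublists (xs ++ zs))
        ≈⟨ +-cong (trans (∑-cong (λ ys → vanish ys pa) S) (∑-zero S)) (∑-sublists-++-vanishingˡ f vanish ps zs) ⟩
      0# + ∑ f (sublists zs)
        ≈⟨ +-identityˡ _ ⟩
      ∑ f (sublists zs) ∎
      where S = sublists (xs ++ zs)

interval : ℕ → ℕ → List ℕ
interval b zero    = []
interval b (suc l) = b ∷ interval (suc b) l

interval-++ : ∀ b l₁ l₂ → interval b (l₁ ℕ.+ l₂) ≡ interval b l₁ ++ interval (b ℕ.+ l₁) l₂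
interval-++ b zero     l₂ = ≡.cong (λ b′ → interval b′ l₂) (≡.sym (ℕ.+-identityʳ b))
interval-++ b (suc l₁) l₂ = ≡.cong (b ∷_) (≡.trans (interval-++ (suc b) l₁ l₂)
                              (≡.cong (λ b′ → interval (suc b) l₁ ++ interval b′ l₂) (≡.sym (ℕ.+-suc b l₁))))

interval-∷ʳ : ∀ b l → interval b (suc l) ≡ interval b l ++ [ b ℕ.+ l ]
interval-∷ʳ b l = ≡.trans (≡.cong (interval b) (ℕ.+-comm 1 l)) (interval-++ b l 1)

interval-suc : ∀ b l → interval (suc b) l ≡ map suc (interval b l)
interval-suc b zero    = ≡.refl
interval-suc b (suc l) = ≡.cong (suc b ∷_) (interval-suc (suc b) l)

All-interval : ∀ b l → All (λ e → b ≤ e × e < b ℕ.+ l) (interval b l)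
All-interval b zero    = []
All-interval b (suc l) rewrite ℕ.+-suc b l =
  (ℕ.≤-refl , s≤s (ℕ.m≤m+n b l)) ∷ All.map (λ (b<e , e<) → ℕ.<⇒≤ b<e , e<) (All-interval (suc b) l)

oneTo≡interval : ∀ n → oneTo n ≡ interval 1 n
oneTo≡interval zero    = ≡.refl
oneTo≡interval (suc n) = begin
  map suc (upTo (suc n))         ≡⟨ ≡.cong (map suc) (≡.sym (List.upTo-∷ʳ n)) ⟩
  map suc (upTo n ++ [ n ])      ≡⟨ List.map-++ suc (upTo n) [ n ] ⟩
  oneTo n ++ [ suc n ]           ≡⟨ ≡.cong (_++ [ suc n ]) (oneTo≡interval n) ⟩
  interval 1 n ++ [ suc n ]      ≡⟨ ≡.sym (interval-∷ʳ 1 n) ⟩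
  interval 1 (suc n)             ∎
  where open ≡.≡-Reasoning

sum-∷ʳ : ∀ R c → sum (R ++ [ c ]) ≡ c ℕ.+ sum R
sum-∷ʳ R c = ≡.trans (sum-++ R [ c ]) (≡.trans (≡.cong (sum R ℕ.+_) (ℕ.+-identityʳ c)) (ℕ.+-comm (sum R) c))

length-∷ʳ : {A : Set} (R : List A) (c : A) → length (R ++ [ c ]) ≡ suc (length R)
length-∷ʳ R c = ≡.trans (List.length-++ R) (ℕ.+-comm (length R) 1)

largest-≤ : ∀ {π M} → All (_≤ M) π → largest π ≤ M
largest-≤ = List.foldr-preservesᵇ ℕ.⊔-lub z≤n

largest-∷ʳ-≥ : ∀ R M → M ≤ largest (R ++ [ M ])
largest-∷ʳ-≥ R M rewrite List.foldr-++ ℕ._⊔_ 0 R [ M ] =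
  List.foldr-preservesʳ {P = M ≤_} (λ a → ℕ.m≤n⇒m≤o⊔n a) (ℕ.m≤m⊔n M 0) R

largest-∷ʳ : ∀ {R M} → All (_≤ M) R → largest (R ++ [ M ]) ≡ M
largest-∷ʳ {R} {M} R≤M = ℕ.≤-antisym (largest-≤ (++⁺ R≤M (ℕ.≤-refl ∷ []))) (largest-∷ʳ-≥ R M)

smallest-∷-≤ : ∀ a R → smallest (a ∷ R) ≤ a
smallest-∷-≤ a R = List.foldr-preservesʳ {P = _≤ a} (λ b → ℕ.m≤n⇒o⊓m≤n b) ℕ.≤-refl R

smallest-≤ : ∀ {π M} → All (_≤ M) π → smallest π ≤ M
smallest-≤ []                = z≤n
smallest-≤ {a ∷ R} (a≤M ∷ _) = ℕ.≤-trans (smallest-∷-≤ a R) a≤M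

smallest-∷ʳ-≤ : ∀ R M → smallest (R ++ [ M ]) ≤ M
smallest-∷ʳ-≤ []      M = ℕ.≤-refl
smallest-∷ʳ-≤ (a ∷ R) M rewrite List.foldr-++ ℕ._⊓_ a R [ M ] =
  List.foldr-preservesʳ {P = _≤ M} (λ b → ℕ.m≤n⇒o⊓m≤n b) (ℕ.m⊓n≤m M a) R

smallest-∷ʳ-≥ : ∀ {c R M} → c ≤ M → All (c ≤_) R → c ≤ smallest (R ++ [ M ])
smallest-∷ʳ-≥ c≤M []          = c≤M
smallest-∷ʳ-≥ c≤M (c≤a ∷ c≤R) = List.foldr-preservesᵇ ℕ.⊓-glb c≤a (++⁺ c≤R (c≤M ∷ []))

m∸n+n≤o : ∀ m n {o} → m ≤ o → n ≤ o → m ∸ n ℕ.+ n ≤ o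
m∸n+n≤o m       zero    {o}     m≤o       _         = ≡.subst (_≤ o) (≡.sym (ℕ.+-identityʳ m)) m≤o
m∸n+n≤o zero    (suc n)         _         n≤o       = n≤o
m∸n+n≤o (suc m) (suc n) {suc o} (s≤s m≤o) (s≤s n≤o) =
  ≡.subst (_≤ suc o) (≡.sym (ℕ.+-suc (m ∸ n) n)) (s≤s (m∸n+n≤o m n m≤o n≤o))

module Coefficients where
  open import Data.Integer using (_+_; _-_; -_; _*_)

  ℤ-ring : CommutativeRing _ _
  ℤ-ring = ℤ.+-*-commutativeRing

  open ListSum ℤ-ring public using () renaming (∑ to ∑ᶻ)
  open ListSum ℤ-ring using (∑-cong; ∑-congᴬ; ∑-zero; ∑-neg; ∑-sublists-∷; ∑-sublists-∷ʳ; ∑-sublists-++-vanishingˡ)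
  open ≡.≡-Reasoning

  when : Bool → ℤ → ℤ
  when b z = if b then z else 0ℤ

  shift : ℕ → (ℕ → ℤ) → ℕ → ℤ
  shift zero    f k       = f k
  shift (suc c) f zero    = 0ℤ
  shift (suc c) f (suc k) = shift c f k

  shift-below : ∀ {c k} f → k < c → shift c f k ≡ 0ℤ
  shift-below {suc c} {zero}  f _         = ≡.refl
  shift-below {suc c} {suc k} f (s≤s k<c) = shift-below f k<c

  shift-above : ∀ {c k} f → c ≤ k → shift c f k ≡ f (k ∸ c)
  shift-above {zero}          f _         = ≡.refl
  shift-above {suc c} {suc k} f (s≤s c≤k) = shift-above f c≤k

  shift-cong : ∀ c {k} {f g : ℕ → ℤ} → (∀ j → j ≤ k → f j ≡ g j) → shift c f k ≡ shift c g k
  shift-cong zero            f≈g = f≈g _ ℕ.≤-refl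
  shift-cong (suc c) {zero}  f≈g = ≡.refl
  shift-cong (suc c) {suc k} f≈g = shift-cong c (λ j j≤k → f≈g j (ℕ.m≤n⇒m≤1+n j≤k))

  shift-shift : ∀ a b f k → shift a (shift b f) k ≡ shift (a ℕ.+ b) f k
  shift-shift zero    b f k       = ≡.refl
  shift-shift (suc a) b f zero    = ≡.refl
  shift-shift (suc a) b f (suc k) = shift-shift a b f k

  shift-+ : ∀ c f g k → shift c (λ j → f j + g j) k ≡ shift c f k + shift c g k
  shift-+ zero    f g k       = ≡.refl
  shift-+ (suc c) f g zero    = ≡.refl
  shift-+ (suc c) f g (suc k) = shift-+ c f g k

  shift-zero : ∀ c k → shift c (λ _ → 0ℤ) k ≡ 0ℤ
  shift-zero zero    k       = ≡.refl
  shift-zero (suc c) zero    = ≡.refl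
  shift-zero (suc c) (suc k) = shift-zero c k

  shift-∑ : {A : Set} (c : ℕ) (g : A → ℕ → ℤ) (xs : List A) (k : ℕ) →
            shift c (λ j → ∑ᶻ (λ a → g a j) xs) k ≡ ∑ᶻ (λ a → shift c (g a) k) xs
  shift-∑ zero    g xs k       = ≡.refl
  shift-∑ (suc c) g xs zero    = ≡.sym (∑-zero xs)
  shift-∑ (suc c) g xs (suc k) = shift-∑ c g xs k

  shift-when : ∀ c s z k → shift c (λ j → when (s ≡ᵇ j) z) k ≡ when (c ℕ.+ s ≡ᵇ k) z
  shift-when zero    s z k       = ≡.refl
  shift-when (suc c) s z zero    = ≡.refl
  shift-when (suc c) s z (suc k) = shift-when c s z k

  𝟙 : ℕ → ℤ
  𝟙 zero    = 1ℤ
  𝟙 (suc k) = 0ℤ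

  𝟙-nonZero : ∀ k → .{{NonZero k}} → 𝟙 k ≡ 0ℤ
  𝟙-nonZero (suc k) = ≡.refl

  multiples : ℕ → ℕ → ℤ
  multiples x k = when (does (x ∣? k)) 1ℤ

  multiples-below : ∀ {x} k → k < x → multiples x k ≡ 𝟙 k
  multiples-below {x} zero    _   rewrite dec-true (x ∣? 0) (x ∣0) = ≡.refl
  multiples-below {x} (suc k) k<x rewrite dec-false (x ∣? suc k) (λ x∣k → ℕ.<⇒≱ k<x (∣⇒≤ x∣k)) = ≡.refl

  multiples-above : ∀ {x k} → x ≤ k → multiples x k ≡ multiples x (k ∸ x)
  multiples-above {x} {k} x≤k = ≡.cong (λ b → when b 1ℤ) (does-⇔ (mk⇔ to from) (x ∣? k) (x ∣? (k ∸ x)))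
    where
    x+[k∸x]≡k = ℕ.m+[n∸m]≡n x≤k
    to : x ∣ k → x ∣ k ∸ x
    to x∣k = ∣m+n∣m⇒∣n (≡.subst (x ∣_) (≡.sym x+[k∸x]≡k) x∣k) ∣-refl
    from : x ∣ k ∸ x → x ∣ k
    from x∣k∸x = ≡.subst (x ∣_) x+[k∸x]≡k (∣m∣n⇒∣m+n ∣-refl x∣k∸x)

  multiples-rec : ∀ y k → multiples (suc y) k ≡ 𝟙 k + shift (suc y) (multiples (suc y)) k
  multiples-rec y k with ℕ.≤-<-connex (suc y) k
  ... | inj₂ k<x = begin
    multiples (suc y) k                        ≡⟨ multiples-below k k<x ⟩
    𝟙 k                                        ≡⟨ ≡.sym (ℤ.+-identityʳ (𝟙 k)) ⟩
    𝟙 k + 0ℤ                                   ≡⟨ ≡.cong (λ z → 𝟙 k + z) (≡.sym (shift-below _ k<x)) ⟩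
    𝟙 k + shift (suc y) (multiples (suc y)) k  ∎
  ... | inj₁ x≤k@(s≤s _) = begin
    multiples (suc y) k                        ≡⟨ multiples-above x≤k ⟩
    multiples (suc y) (k ∸ suc y)              ≡⟨ ≡.sym (ℤ.+-identityˡ _) ⟩
    0ℤ + multiples (suc y) (k ∸ suc y)         ≡⟨ ≡.cong (λ z → 0ℤ + z) (≡.sym (shift-above _ x≤k)) ⟩
    𝟙 k + shift (suc y) (multiples (suc y)) k  ∎

  block : ℕ → ℕ → ℤ
  block zero    j       = 0ℤ
  block (suc s) zero    = 1ℤ
  block (suc s) (suc j) = block s j

  block-< : ∀ {s j} → j < s → block s j ≡ 1ℤ
  block-< {suc s} {zero}  _         = ≡.refl
  block-< {suc s} {suc j} (s≤s j<s) = block-< j<s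

  block-≥ : ∀ {s j} → s ≤ j → block s j ≡ 0ℤ
  block-≥ {zero}          _         = ≡.refl
  block-≥ {suc s} {suc j} (s≤s s≤j) = block-≥ s≤j

  window : ℕ → ℕ → ℕ → ℤ
  window a s = shift (suc a) (block s)

  window-below : ∀ a s {x} → x ≤ a → window a s x ≡ 0ℤ
  window-below a s x≤a = shift-below _ (s≤s x≤a)

  window-above : ∀ a s {x} → a ℕ.+ s < x → window a s x ≡ 0ℤ
  window-above a s {x} a+s<x = ≡.trans (shift-above (block s) a<x) (block-≥ s≤x∸[1+a])
    where
    a<x = ℕ.≤-trans (s≤s (ℕ.m≤m+n a s)) a+s<x
    s≤x∸[1+a] = ≡.subst (_≤ x ∸ suc a) (ℕ.m+n∸m≡n (suc a) s) (ℕ.∸-monoˡ-≤ (suc a) a+s<x)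

  window-inside : ∀ a s {x} → a < x → x ≤ a ℕ.+ s → window a s x ≡ 1ℤ
  window-inside a s {x} a<x x≤a+s = ≡.trans (shift-above (block s) a<x) (block-< x∸[1+a]<s)
    where
    x∸[1+a]<s = ≡.subst (_≤ s) (ℕ.+-∸-assoc 1 a<x)
                  (≡.subst (x ∸ a ≤_) (ℕ.m+n∸m≡n a s) (ℕ.∸-monoˡ-≤ a x≤a+s))

  weight : List ℕ → ℕ → ℤ
  weight R k = when (sum R ≡ᵇ k) (signR ℤ-ring (length R))

  signedSubsets : List ℕ → ℕ → ℤ
  signedSubsets W k = ∑ᶻ (λ R → weight R k) (sublists W)

  ∑-weight-extend : ∀ c (g : List ℕ → List ℕ) →
    (∀ R → sum (g R) ≡ c ℕ.+ sum R) → (∀ R → length (g R) ≡ suc (length R)) →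
    ∀ W k → ∑ᶻ (λ R → weight (g R) k) (sublists W) ≡ - shift c (signedSubsets W) k
  ∑-weight-extend c g sum-g length-g W k = begin
    ∑ᶻ (λ R → weight (g R) k) (sublists W)          ≡⟨ ∑-cong extend (sublists W) ⟩
    ∑ᶻ (λ R → - shift c (weight R) k) (sublists W)  ≡⟨ ∑-neg _ (sublists W) ⟩
    - ∑ᶻ (λ R → shift c (weight R) k) (sublists W)  ≡⟨ ≡.cong -_ (≡.sym (shift-∑ c weight (sublists W) k)) ⟩
    - shift c (signedSubsets W) k                   ∎
    where
    extend : ∀ R → weight (g R) k ≡ - shift c (weight R) k
    extend R rewrite sum-g R | length-g R | shift-when c (sum R) (signR ℤ-ring (length R)) k
      with c ℕ.+ sum R ≡ᵇ k
    ... | true  = ≡.refl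
    ... | false = ≡.refl

  signedSubsets-∷ : ∀ w W k → signedSubsets (w ∷ W) k ≡ signedSubsets W k - shift w (signedSubsets W) k
  signedSubsets-∷ w W k = begin
    signedSubsets (w ∷ W) k
      ≡⟨ ∑-sublists-∷ (λ R → weight R k) w W ⟩
    ∑ᶻ (λ R → weight (w ∷ R) k) (sublists W) + signedSubsets W k
      ≡⟨ ≡.cong (_+ signedSubsets W k) (∑-weight-extend w (w ∷_) (λ _ → ≡.refl) (λ _ → ≡.refl) W k) ⟩
    - shift w (signedSubsets W) k + signedSubsets W k
      ≡⟨ ℤ.+-comm (- shift w (signedSubsets W) k) _ ⟩
    signedSubsets W k - shift w (signedSubsets W) k ∎

  signedSubsets-∷ʳ : ∀ W c k → signedSubsets (W ++ [ c ]) k ≡ signedSubsets W k - shift c (signedSubsets W) k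
  signedSubsets-∷ʳ W c k = begin
    signedSubsets (W ++ [ c ]) k
      ≡⟨ ∑-sublists-∷ʳ (λ R → weight R k) W c ⟩
    ∑ᶻ (λ R → weight (R ++ [ c ]) k) (sublists W) + signedSubsets W k
      ≡⟨ ≡.cong (_+ signedSubsets W k) (∑-weight-extend c (_++ [ c ]) (λ R → sum-∷ʳ R c) (λ R → length-∷ʳ R c) W k) ⟩
    - shift c (signedSubsets W) k + signedSubsets W k
      ≡⟨ ℤ.+-comm (- shift c (signedSubsets W) k) _ ⟩
    signedSubsets W k - shift c (signedSubsets W) k ∎

  signedSubsets-above : ∀ {k W} → All (k <_) W → signedSubsets W k ≡ 𝟙 k
  signedSubsets-above {zero}  []                = ≡.refl
  signedSubsets-above {suc k} []                = ≡.refl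
  signedSubsets-above {k} {w ∷ W} (k<w ∷ k<W) = begin
    signedSubsets (w ∷ W) k                          ≡⟨ signedSubsets-∷ w W k ⟩
    signedSubsets W k - shift w (signedSubsets W) k  ≡⟨ ≡.cong₂ _-_ (signedSubsets-above k<W) (shift-below _ k<w) ⟩
    𝟙 k - 0ℤ                                         ≡⟨ ℤ.+-identityʳ (𝟙 k) ⟩
    𝟙 k                                              ∎

  module Telescope (y : ℕ) where

    x : ℕ
    x = suc y

    A : ℕ → ℕ → ℤ
    A t = signedSubsets (interval (suc t) y)

    A-recurrence : ∀ t k → A t k - shift (x ℕ.+ t) (A t) k ≡ A (suc t) k - shift (suc t) (A (suc t)) k
    A-recurrence t k = begin
      A t k - shift (x ℕ.+ t) (A t) k
        ≡⟨ ≡.cong (λ c → A t k - shift (suc c) (A t) k) (ℕ.+-comm y t) ⟩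
      A t k - shift (suc t ℕ.+ y) (A t) k
        ≡⟨ ≡.sym (signedSubsets-∷ʳ (interval (suc t) y) (suc t ℕ.+ y) k) ⟩
      signedSubsets (interval (suc t) y ++ [ suc t ℕ.+ y ]) k
        ≡⟨ ≡.cong (λ W → signedSubsets W k) (≡.sym (interval-∷ʳ (suc t) y)) ⟩
      signedSubsets (interval (suc t) x) k
        ≡⟨ signedSubsets-∷ (suc t) (interval (suc (suc t)) y) k ⟩
      A (suc t) k - shift (suc t) (A (suc t)) k ∎

    G : ℕ → ℕ → ℤ
    G zero    k = 0ℤ
    G (suc N) k = shift N (A N) k + G N k

    shift-G : ∀ N k → shift x (G N) k ≡ G (suc N) k - A N k
    shift-G zero    k = ≡.trans (shift-zero x k) (≡.sym (cancel (A 0 k)))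
      where
      cancel : ∀ a → (a + 0ℤ) - a ≡ 0ℤ
      cancel = solve-∀
    shift-G (suc N) k = begin
      shift x (G (suc N)) k
        ≡⟨ shift-+ x (shift N (A N)) (G N) k ⟩
      shift x (shift N (A N)) k + shift x (G N) k
        ≡⟨ ≡.cong₂ _+_ (shift-shift x N (A N) k) (shift-G N k) ⟩
      shift (x ℕ.+ N) (A N) k + (G (suc N) k - A N k)
        ≡⟨ telescope (A N k) (shift (x ℕ.+ N) (A N) k) (A (suc N) k) (shift (suc N) (A (suc N)) k) (G (suc N) k)
                     (A-recurrence N k) ⟩
      G (suc (suc N)) k - A (suc N) k ∎
      where
      telescope : ∀ a p a′ p′ g → a - p ≡ a′ - p′ → p + (g - a) ≡ (p′ + g) - a′
      telescope a p a′ p′ g e = ≡.trans (rearrange a p g) (≡.trans (≡.cong (λ z → g - z) e) (rearrange′ a′ p′ g))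
        where
        rearrange : ∀ a p g → p + (g - a) ≡ g - (a - p)
        rearrange = solve-∀
        rearrange′ : ∀ a′ p′ g → g - (a′ - p′) ≡ (p′ + g) - a′
        rearrange′ = solve-∀

    G-rec : ∀ {N k} → k < N → G N k ≡ 𝟙 k + shift x (G N) k
    G-rec {N} {k} k<N = begin
      G N k                               ≡⟨ cancel (G N k) (𝟙 k) ⟩
      𝟙 k + ((0ℤ + G N k) - 𝟙 k)          ≡⟨ ≡.cong₂ (λ s a → 𝟙 k + ((s + G N k) - a)) (≡.sym (shift-below (A N) k<N)) (≡.sym A-N) ⟩
      𝟙 k + (G (suc N) k - A N k)         ≡⟨ ≡.cong (λ z → 𝟙 k + z) (≡.sym (shift-G N k)) ⟩
      𝟙 k + shift x (G N) k               ∎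
      where
      cancel : ∀ g e → g ≡ e + ((0ℤ + g) - e)
      cancel = solve-∀
      A-N : A N k ≡ 𝟙 k
      A-N = signedSubsets-above (All.map (λ (N<e , _) → ℕ.<-≤-trans k<N (ℕ.<⇒≤ N<e)) (All-interval (suc N) y))

    -- Strong induction on k: as x ≥ 1, shift x f k only involves values of f below k.
    G≡multiples : ∀ {N} k → k < N → G N k ≡ multiples x k
    G≡multiples {N} = <-rec (λ k → k < N → G N k ≡ multiples x k) step
      where
      Below : ℕ → Set
      Below k = ∀ {j} → j < k → j < N → G N j ≡ multiples x j
      shift-x-agrees : ∀ k → Below k → k < N → shift x (G N) k ≡ shift x (multiples x) k
      shift-x-agrees zero    _  _   = ≡.refl
      shift-x-agrees (suc k) ih k<N = shift-cong y (λ j j≤k → ih (s≤s j≤k) (ℕ.<-trans (s≤s j≤k) k<N))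
      step : ∀ k → Below k → k < N → G N k ≡ multiples x k
      step k ih k<N = begin
        G N k                            ≡⟨ G-rec k<N ⟩
        𝟙 k + shift x (G N) k            ≡⟨ ≡.cong (λ z → 𝟙 k + z) (shift-x-agrees k ih k<N) ⟩
        𝟙 k + shift x (multiples x) k    ≡⟨ ≡.sym (multiples-rec y k) ⟩
        multiples x k                    ∎

  partitionCoefficient : ℕ → ℕ → List ℕ → ℤ
  partitionCoefficient n x π =
    when (sum π ≡ᵇ n) (signR ℤ-ring (length π ∸ 1) * window (largest π ∸ smallest π) (smallest π) x)

  coefficient : ℕ → ℕ → ℤ
  coefficient n x = ∑ᶻ (partitionCoefficient n x) (sublists (oneTo n))

  partitionCoefficient-window : ∀ n x π → window (largest π ∸ smallest π) (smallest π) x ≡ 0ℤ →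
                                partitionCoefficient n x π ≡ 0ℤ
  partitionCoefficient-window n x π w≡0 rewrite w≡0 | ℤ.*-zeroʳ (signR ℤ-ring (length π ∸ 1))
    with sum π ≡ᵇ n
  ... | true  = ≡.refl
  ... | false = ≡.refl

  partitionCoefficient-sum : ∀ n x π → sum π ≢ n → partitionCoefficient n x π ≡ 0ℤ
  partitionCoefficient-sum n x π ≢n rewrite dec-false (sum π ℕ.≟ n) ≢n = ≡.refl

  module Bridge (y n : ℕ) where
    open Telescope y

    bounded : ℕ → ℤ
    bounded N = ∑ᶻ (partitionCoefficient n x) (sublists (interval 1 N))

    topped : ℕ → ℤ
    topped N = ∑ᶻ (λ R → partitionCoefficient n x (R ++ [ suc N ])) (sublists (interval 1 N))

    bounded-suc : ∀ N → bounded (suc N) ≡ topped N + bounded N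
    bounded-suc N = ≡.trans (≡.cong (λ L → ∑ᶻ (partitionCoefficient n x) (sublists L)) (interval-∷ʳ 1 N))
                            (∑-sublists-∷ʳ (partitionCoefficient n x) (interval 1 N) (suc N))

    bounded-y : bounded y ≡ 0ℤ
    bounded-y = ≡.trans (∑-congᴬ vanish (All-sublists (All.map (ℕ.≤-pred ∘ proj₂) (All-interval 1 y))))
                        (∑-zero (sublists (interval 1 y)))
      where
      vanish : ∀ {π} → All (_≤ y) π → partitionCoefficient n x π ≡ 0ℤ
      vanish {π} π≤y = partitionCoefficient-window n x π (window-above (largest π ∸ smallest π) (smallest π)
        (s≤s (m∸n+n≤o (largest π) (smallest π) (largest-≤ π≤y) (smallest-≤ π≤y))))

    topped-large : ∀ N → n ≤ N → topped N ≡ 0ℤ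
    topped-large N n≤N = ≡.trans (∑-cong vanish (sublists (interval 1 N))) (∑-zero (sublists (interval 1 N)))
      where
      vanish : ∀ R → partitionCoefficient n x (R ++ [ suc N ]) ≡ 0ℤ
      vanish R = partitionCoefficient-sum n x (R ++ [ suc N ]) λ sum≡n →
        ℕ.<⇒≱ (s≤s n≤N) (≡.subst (suc N ≤_) (≡.trans (≡.sym (sum-∷ʳ R (suc N))) sum≡n) (ℕ.m≤m+n (suc N) (sum R)))

    bounded-stable : ∀ d → bounded (n ℕ.+ d) ≡ bounded n
    bounded-stable zero    = ≡.cong bounded (ℕ.+-identityʳ n)
    bounded-stable (suc d) = begin
      bounded (n ℕ.+ suc d)                 ≡⟨ ≡.cong bounded (ℕ.+-suc n d) ⟩
      bounded (suc (n ℕ.+ d))               ≡⟨ bounded-suc (n ℕ.+ d) ⟩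
      topped (n ℕ.+ d) + bounded (n ℕ.+ d)  ≡⟨ ≡.cong₂ _+_ (topped-large (n ℕ.+ d) (ℕ.m≤m+n n d)) (bounded-stable d) ⟩
      0ℤ + bounded n                        ≡⟨ ℤ.+-identityˡ (bounded n) ⟩
      bounded n                             ∎

    module _ (t : ℕ) where
      M : ℕ
      M = suc (t ℕ.+ y)

      topped-below : ∀ {a} R → a < suc t → partitionCoefficient n x (a ∷ R ++ [ M ]) ≡ 0ℤ
      topped-below {a} R a≤t = partitionCoefficient-window n x (a ∷ R ++ [ M ])
        (window-below (ℓ ∸ s) s (ℕ.m+n≤o⇒m≤o∸n x (ℕ.≤-trans x+s≤M (largest-∷ʳ-≥ (a ∷ R) M))))
        where
        ℓ = largest (a ∷ R ++ [ M ])
        s = smallest (a ∷ R ++ [ M ])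
        x+s≤M : x ℕ.+ s ≤ M
        x+s≤M = ≡.subst (x ℕ.+ s ≤_) (≡.cong suc (ℕ.+-comm y t))
                  (ℕ.+-monoʳ-≤ x (ℕ.≤-trans (smallest-∷-≤ a (R ++ [ M ])) (ℕ.≤-pred a≤t)))

      topped-inside : ∀ {R} → All (λ e → suc t ≤ e × e < suc t ℕ.+ y) R →
                      partitionCoefficient n x (R ++ [ M ]) ≡ shift M (weight R) n
      topped-inside {R} R∈W = begin
        partitionCoefficient n x (R ++ [ M ])
          ≡⟨ ≡.cong₂ (λ σ w → when (σ ≡ᵇ n) (signR ℤ-ring (length (R ++ [ M ]) ∸ 1) * w))
               (sum-∷ʳ R M) (window-inside (ℓ ∸ s) s ℓ∸s<x x≤ℓ∸s+s) ⟩
        when (M ℕ.+ sum R ≡ᵇ n) (signR ℤ-ring (length (R ++ [ M ]) ∸ 1) * 1ℤ)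
          ≡⟨ ≡.cong (when (M ℕ.+ sum R ≡ᵇ n))
               (≡.trans (ℤ.*-identityʳ _) (≡.cong (λ l → signR ℤ-ring (l ∸ 1)) (length-∷ʳ R M))) ⟩
        when (M ℕ.+ sum R ≡ᵇ n) (signR ℤ-ring (length R))
          ≡⟨ ≡.sym (shift-when M (sum R) (signR ℤ-ring (length R)) n) ⟩
        shift M (weight R) n ∎
        where
        ℓ = largest (R ++ [ M ])
        s = smallest (R ++ [ M ])
        ℓ≡M : ℓ ≡ M
        ℓ≡M = largest-∷ʳ (All.map (ℕ.<⇒≤ ∘ proj₂) R∈W)
        t<s : suc t ≤ s
        t<s = smallest-∷ʳ-≥ (s≤s (ℕ.m≤m+n t y)) (All.map proj₁ R∈W)
        ℓ∸s<x : ℓ ∸ s < x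
        ℓ∸s<x rewrite ℓ≡M = s≤s (≡.subst (M ∸ s ≤_) (ℕ.m+n∸m≡n t y) (ℕ.∸-monoʳ-≤ M t<s))
        x≤ℓ∸s+s : x ≤ ℓ ∸ s ℕ.+ s
        x≤ℓ∸s+s rewrite ℓ≡M | ℕ.m∸n+n≡m (smallest-∷ʳ-≤ R M) = s≤s (ℕ.m≤n+m y t)

      topped-window : topped (t ℕ.+ y) ≡ shift (x ℕ.+ t) (A t) n
      topped-window = begin
        topped (t ℕ.+ y)
          ≡⟨ ≡.cong (λ L → ∑ᶻ f (sublists L)) (interval-++ 1 t y) ⟩
        ∑ᶻ f (sublists (interval 1 t ++ W))
          ≡⟨ ∑-sublists-++-vanishingˡ f topped-below (All.map proj₂ (All-interval 1 t)) W ⟩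
        ∑ᶻ f (sublists W)
          ≡⟨ ∑-congᴬ topped-inside (All-sublists (All-interval (suc t) y)) ⟩
        ∑ᶻ (λ R → shift M (weight R) n) (sublists W)
          ≡⟨ ≡.sym (shift-∑ M weight (sublists W) n) ⟩
        shift M (A t) n
          ≡⟨ ≡.cong (λ c → shift (suc c) (A t) n) (ℕ.+-comm t y) ⟩
        shift (x ℕ.+ t) (A t) n ∎
        where
        W = interval (suc t) y
        f : List ℕ → ℤ
        f R = partitionCoefficient n x (R ++ [ M ])

    bounded-G : ∀ t → bounded (t ℕ.+ y) ≡ shift x (G t) n
    bounded-G zero    = ≡.trans bounded-y (≡.sym (shift-zero x n))
    bounded-G (suc t) = begin
      bounded (suc t ℕ.+ y)                              ≡⟨ bounded-suc (t ℕ.+ y) ⟩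
      topped (t ℕ.+ y) + bounded (t ℕ.+ y)               ≡⟨ ≡.cong₂ _+_ (topped-window t) (bounded-G t) ⟩
      shift (x ℕ.+ t) (A t) n + shift x (G t) n          ≡⟨ ≡.cong (_+ shift x (G t) n) (≡.sym (shift-shift x t (A t) n)) ⟩
      shift x (shift t (A t)) n + shift x (G t) n        ≡⟨ ≡.sym (shift-+ x (shift t (A t)) (G t) n) ⟩
      shift x (G (suc t)) n                              ∎

    coefficient≡multiples : .{{NonZero n}} → coefficient n x ≡ multiples x n
    coefficient≡multiples = begin
      coefficient n x                    ≡⟨ ≡.cong (λ L → ∑ᶻ (partitionCoefficient n x) (sublists L)) (oneTo≡interval n) ⟩
      bounded n                          ≡⟨ ≡.sym (bounded-stable x) ⟩
      bounded (n ℕ.+ x)                  ≡⟨ ≡.cong bounded (ℕ.+-suc n y) ⟩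
      bounded (suc n ℕ.+ y)              ≡⟨ bounded-G (suc n) ⟩
      shift x (G (suc n)) n              ≡⟨ shift-cong x {n} (λ j j≤n → G≡multiples j (s≤s j≤n)) ⟩
      shift x (multiples x) n            ≡⟨ ≡.sym (ℤ.+-identityˡ _) ⟩
      0ℤ + shift x (multiples x) n       ≡⟨ ≡.cong (_+ shift x (multiples x) n) (≡.sym (𝟙-nonZero n)) ⟩
      𝟙 n + shift x (multiples x) n      ≡⟨ ≡.sym (multiples-rec y n) ⟩
      multiples x n                      ∎

  coefficient≡multiples : ∀ n {x} → 1 ≤ x → .{{NonZero n}} → coefficient n x ≡ multiples x n
  coefficient≡multiples n {suc y} _ = Bridge.coefficient≡multiples y n

open Coefficients

module Transfer {c ℓ : Level} (R : CommutativeRing c ℓ) where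
  open CommutativeRing R
  open ListSum R
  open import Algebra.Properties.Monoid.Mult +-monoid using (×-homo-+) renaming (_×_ to _⨉_)
  open import Algebra.Properties.Ring ring using (-‿distribˡ-*; -0#≈0#; -‿involutive; -‿+-comm)
  open import Algebra.Properties.CommutativeSemigroup +-commutativeSemigroup using (interchange)
  open import Relation.Binary.Reasoning.Setoid setoid

  ⟦_⟧ : ℤ → Carrier
  ⟦ + n ⟧      = n ⨉ 1#
  ⟦ -[1+ n ] ⟧ = - (suc n ⨉ 1#)

  ⟦⊖⟧ : ∀ m n → ⟦ m ℤ.⊖ n ⟧ ≈ m ⨉ 1# - n ⨉ 1#
  ⟦⊖⟧ m       zero    = sym (trans (+-congˡ -0#≈0#) (+-identityʳ _))
  ⟦⊖⟧ zero    (suc n) = sym (+-identityˡ _)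
  ⟦⊖⟧ (suc m) (suc n) = begin
    ⟦ suc m ℤ.⊖ suc n ⟧                    ≡⟨ ≡.cong ⟦_⟧ (ℤ.[1+m]⊖[1+n]≡m⊖n m n) ⟩
    ⟦ m ℤ.⊖ n ⟧                            ≈⟨ ⟦⊖⟧ m n ⟩
    m ⨉ 1# - n ⨉ 1#                        ≈⟨ sym (+-identityˡ _) ⟩
    0# + (m ⨉ 1# - n ⨉ 1#)                 ≈⟨ +-congʳ (sym (-‿inverseʳ 1#)) ⟩
    (1# - 1#) + (m ⨉ 1# - n ⨉ 1#)          ≈⟨ interchange _ _ _ _ ⟩
    (1# + m ⨉ 1#) + (- 1# - n ⨉ 1#)        ≈⟨ +-congˡ (-‿+-comm 1# (n ⨉ 1#)) ⟩
    (1# + m ⨉ 1#) - (1# + n ⨉ 1#)          ∎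

  ⟦+⟧ : ∀ i j → ⟦ i ℤ.+ j ⟧ ≈ ⟦ i ⟧ + ⟦ j ⟧
  ⟦+⟧ (+ m)    (+ n)    = ×-homo-+ 1# m n
  ⟦+⟧ (+ m)    -[1+ n ] = ⟦⊖⟧ m (suc n)
  ⟦+⟧ -[1+ m ] (+ n)    = trans (⟦⊖⟧ n (suc m)) (+-comm _ _)
  ⟦+⟧ -[1+ m ] -[1+ n ] = begin
    - (suc (suc (m ℕ.+ n)) ⨉ 1#)           ≡⟨ ≡.cong (λ k → - (suc k ⨉ 1#)) (≡.sym (ℕ.+-suc m n)) ⟩
    - ((suc m ℕ.+ suc n) ⨉ 1#)             ≈⟨ -‿cong (×-homo-+ 1# (suc m) (suc n)) ⟩
    - (suc m ⨉ 1# + suc n ⨉ 1#)            ≈⟨ sym (-‿+-comm _ _) ⟩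
    - (suc m ⨉ 1#) - suc n ⨉ 1#            ∎

  ⟦1⟧ : ⟦ 1ℤ ⟧ ≈ 1#
  ⟦1⟧ = +-identityʳ 1#

  ⟦-⟧ : ∀ i → ⟦ ℤ.- i ⟧ ≈ - ⟦ i ⟧
  ⟦-⟧ (+ zero)  = sym -0#≈0#
  ⟦-⟧ (+ suc n) = refl
  ⟦-⟧ -[1+ n ]  = sym (-‿involutive _)

  ⟦signR*⟧ : ∀ k z → ⟦ signR ℤ-ring k ℤ.* z ⟧ ≈ signR R k * ⟦ z ⟧
  ⟦signR*⟧ zero    z = trans (reflexive (≡.cong ⟦_⟧ (ℤ.*-identityˡ z))) (sym (*-identityˡ _))
  ⟦signR*⟧ (suc k) z = begin
    ⟦ ℤ.- signR ℤ-ring k ℤ.* z ⟧    ≡⟨ ≡.cong ⟦_⟧ (≡.sym (ℤ.neg-distribˡ-* (signR ℤ-ring k) z)) ⟩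
    ⟦ ℤ.- (signR ℤ-ring k ℤ.* z) ⟧  ≈⟨ ⟦-⟧ (signR ℤ-ring k ℤ.* z) ⟩
    - ⟦ signR ℤ-ring k ℤ.* z ⟧      ≈⟨ -‿cong (⟦signR*⟧ k z) ⟩
    - (signR R k * ⟦ z ⟧)           ≈⟨ -‿distribˡ-* _ _ ⟩
    - signR R k * ⟦ z ⟧             ∎

  ⟦∑⟧ : {A : Set} (f : A → ℤ) (xs : List A) → ⟦ ∑ᶻ f xs ⟧ ≈ ∑ (⟦_⟧ ∘ f) xs
  ⟦∑⟧ f []       = refl
  ⟦∑⟧ f (x ∷ xs) = trans (⟦+⟧ (f x) (∑ᶻ f xs)) (+-congˡ (⟦∑⟧ f xs))

  ⟦when1⟧* : ∀ b t → ⟦ when b 1ℤ ⟧ * t ≈ (if b then t else 0#)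
  ⟦when1⟧* true  t = trans (*-congʳ ⟦1⟧) (*-identityˡ t)
  ⟦when1⟧* false t = zeroˡ t

  ∑-interval-suc : (f : ℕ → Carrier) (b l : ℕ) → ∑ f (interval (suc b) l) ≈ ∑ (f ∘ suc) (interval b l)
  ∑-interval-suc f b l = trans (reflexive (≡.cong (∑ f) (interval-suc b l))) (∑-map f suc (interval b l))

  ∑-block : ∀ s n → s ≤ n → (f : ℕ → Carrier) →
            ∑ (λ j → ⟦ block s j ⟧ * f j) (interval 0 n) ≈ ∑ f (interval 0 s)
  ∑-block zero    n       _         f = trans (∑-cong (λ j → zeroˡ (f j)) (interval 0 n)) (∑-zero (interval 0 n))
  ∑-block (suc s) (suc n) (s≤s s≤n) f = +-cong (trans (*-congʳ ⟦1⟧) (*-identityˡ (f 0))) (begin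
    ∑ (λ j → ⟦ block (suc s) j ⟧ * f j) (interval 1 n)   ≈⟨ ∑-interval-suc _ 0 n ⟩
    ∑ (λ j → ⟦ block s j ⟧ * f (suc j)) (interval 0 n)   ≈⟨ ∑-block s n s≤n (f ∘ suc) ⟩
    ∑ (f ∘ suc) (interval 0 s)                           ≈⟨ sym (∑-interval-suc f 0 s) ⟩
    ∑ f (interval 1 s)                                   ∎)

  ∑-window : ∀ a s n → a ℕ.+ s ≤ n → (T : ℕ → Carrier) →
             ∑ (λ x → ⟦ window a s x ⟧ * T x) (interval 1 n) ≈ ∑ (λ j → T (a ℕ.+ j)) (interval 1 s)
  ∑-window zero    s n       s≤n       T = begin
    ∑ (λ x → ⟦ window 0 s x ⟧ * T x) (interval 1 n)     ≈⟨ ∑-interval-suc _ 0 n ⟩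
    ∑ (λ j → ⟦ block s j ⟧ * T (suc j)) (interval 0 n)  ≈⟨ ∑-block s n s≤n (T ∘ suc) ⟩
    ∑ (T ∘ suc) (interval 0 s)                          ≈⟨ sym (∑-interval-suc T 0 s) ⟩
    ∑ T (interval 1 s)                                  ∎
  ∑-window (suc a) s (suc n) (s≤s a+s≤n) T = trans (+-cong (zeroˡ (T 1)) (begin
    ∑ (λ x → ⟦ window (suc a) s x ⟧ * T x) (interval 2 n)     ≈⟨ ∑-interval-suc _ 1 n ⟩
    ∑ (λ x → ⟦ window a s x ⟧ * T (suc x)) (interval 1 n)     ≈⟨ ∑-window a s n a+s≤n (T ∘ suc) ⟩
    ∑ (λ j → T (suc a ℕ.+ j)) (interval 1 s)                  ∎)) (+-identityˡ _)

  summand≈∑-window : ∀ b k a s n → a ℕ.+ s ≤ n → (T : ℕ → Carrier) →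
    (if b then signR R k * ∑ (λ j → T (a ℕ.+ j)) (oneTo s) else 0#)
    ≈ ∑ (λ x → ⟦ when b (signR ℤ-ring k ℤ.* window a s x) ⟧ * T x) (oneTo n)
  summand≈∑-window false k a s n _ T = sym (trans (∑-cong (λ x → zeroˡ (T x)) (oneTo n)) (∑-zero (oneTo n)))
  summand≈∑-window true  k a s n a+s≤n T = begin
    signR R k * ∑ (λ j → T (a ℕ.+ j)) (oneTo s)
      ≡⟨ ≡.cong (λ L → signR R k * ∑ (λ j → T (a ℕ.+ j)) L) (oneTo≡interval s) ⟩
    signR R k * ∑ (λ j → T (a ℕ.+ j)) (interval 1 s)
      ≈⟨ *-congˡ (sym (∑-window a s n a+s≤n T)) ⟩
    signR R k * ∑ (λ x → ⟦ window a s x ⟧ * T x) (interval 1 n)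
      ≈⟨ ∑-*ˡ (signR R k) _ (interval 1 n) ⟩
    ∑ (λ x → signR R k * (⟦ window a s x ⟧ * T x)) (interval 1 n)
      ≈⟨ ∑-cong (λ x → trans (sym (*-assoc _ _ _)) (*-congʳ (sym (⟦signR*⟧ k (window a s x))))) (interval 1 n) ⟩
    ∑ (λ x → ⟦ signR ℤ-ring k ℤ.* window a s x ⟧ * T x) (interval 1 n)
      ≡⟨ ≡.cong (∑ (λ x → ⟦ signR ℤ-ring k ℤ.* window a s x ⟧ * T x)) (≡.sym (oneTo≡interval n)) ⟩
    ∑ (λ x → ⟦ signR ℤ-ring k ℤ.* window a s x ⟧ * T x) (oneTo n) ∎

  ∑-𝒟≈∑-divisors : ∀ n .{{_ : NonZero n}} (T : ℕ → Carrier) →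
    ∑ (λ π → signR R (length π ∸ 1) * ∑ (λ j → T (largest π ∸ smallest π ℕ.+ j)) (oneTo (smallest π))) (𝒟 n)
    ≈ ∑ T (divisors n)
  ∑-𝒟≈∑-divisors n T = begin
    ∑ summand (𝒟 n)
      ≈⟨ ∑-filter (λ π → sum π ℕ.≟ n) summand P ⟩
    ∑ (λ π → if sum π ≡ᵇ n then summand π else 0#) P
      ≈⟨ ∑-congᴬ expand (All-sublists (All.map proj₂ I-bounds)) ⟩
    ∑ (λ π → ∑ (λ x → ⟦ partitionCoefficient n x π ⟧ * T x) I) P
      ≈⟨ ∑-swap (λ π x → ⟦ partitionCoefficient n x π ⟧ * T x) P I ⟩
    ∑ (λ x → ∑ (λ π → ⟦ partitionCoefficient n x π ⟧ * T x) P) I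
      ≈⟨ ∑-cong (λ x → sym (trans (*-congʳ (⟦∑⟧ (partitionCoefficient n x) P)) (∑-*ʳ (T x) _ P))) I ⟩
    ∑ (λ x → ⟦ coefficient n x ⟧ * T x) I
      ≈⟨ ∑-congᴬ (λ (1≤x , _) → reflexive (≡.cong (λ z → ⟦ z ⟧ * _) (coefficient≡multiples n 1≤x))) I-bounds ⟩
    ∑ (λ x → ⟦ multiples x n ⟧ * T x) I
      ≈⟨ ∑-cong (λ x → ⟦when1⟧* (does (x ∣? n)) (T x)) I ⟩
    ∑ (λ x → if does (x ∣? n) then T x else 0#) I
      ≈⟨ sym (∑-filter (_∣? n) T I) ⟩
    ∑ T (divisors n) ∎
    where
    P = sublists (oneTo n)
    I = oneTo n
    summand : List ℕ → Carrier
    summand π = signR R (length π ∸ 1) * ∑ (λ j → T (largest π ∸ smallest π ℕ.+ j)) (oneTo (smallest π))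
    I-bounds : All (λ x → 1 ≤ x × x ≤ n) I
    I-bounds = ≡.subst (All _) (≡.sym (oneTo≡interval n))
                 (All.map (λ (1≤x , x<1+n) → 1≤x , ℕ.≤-pred x<1+n) (All-interval 1 n))
    expand : ∀ {π} → All (_≤ n) π →
             (if sum π ≡ᵇ n then summand π else 0#) ≈ ∑ (λ x → ⟦ partitionCoefficient n x π ⟧ * T x) I
    expand {π} π≤n = summand≈∑-window (sum π ≡ᵇ n) (length π ∸ 1) (largest π ∸ smallest π) (smallest π) n
                       (m∸n+n≤o (largest π) (smallest π) (largest-≤ π≤n) (smallest-≤ π≤n)) T

theorem2p4 : {c ℓ : Level} (R : CommutativeRing c ℓ) (ι : ℚ → CommutativeRing.Carrier R)
    → IsRingHomFromℚ R ι
    → (m : ℤ) (n : ℕ) → .{{NonZero n}} → (a : CommutativeRing.Carrier R)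
    → CommutativeRing._≈_ R (LHS R ι m a n) (RHS R ι m a n)
theorem2p4 R ι _ m n a = Transfer.∑-𝒟≈∑-divisors R n (term R ι m a)
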